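{- For integers $k\ge1$ and $n\ge4$ define \[ B_1(n,k)=\left\lceil\tfrac{4n}{3}\right\rceil(k+1)+\begin{cases}k+1,& n\equiv0\pmod3,\\0,&n\equiv1\pmod3,\\k,&n\equiv2\pmod3,\end{cases} \] \[ B_2(n,k)=6(n-2)\left\lceil\tfrac{k+4}{5}\right\rceil+12\left\lceil\tfrac{k+3-\lceil\frac{k+4}{5}\rceil}{3}\right\rceil, \] \[ B_3(n,k)=6(n-2)\left\lceil\tfrac{k+5}{5}\right\rceil+12\left\lceil\tfrac{k+3-\lceil\frac{k+5}{5}\rceil}{3}\right\rceil-2\left\lceil\tfrac n2\right\rceil. \] Then: (i) if $k\equiv 1\pmod 5$ and $k\ge 31$, then for all sufficiently large $n$, $B_2(n,k)$ is the smallest of $B_1(n,k),B_2(n,k),B_3(n,k)$; (ii) if $k\not\equiv1\pmod5$ and $k\ge 53$, then for all sufficiently large $n$, $B_3(n,k)$ is the smallest of $B_1(n,k),B_2(n,k),B_3(n,k)$.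
   Context: $B_1,B_2,B_3$ are upper bounds on the $[k]$-Roman domination number of the cylindrical grid $C_6\Box P_n$. In particular, under (i) or (ii), for all sufficiently large $n$ at least one of $B_2,B_3$ is smaller than $B_1$. -}

module Defs where

open import Data.Nat using (ℕ; suc; _+_; _*_; _∸_; _/_; _%_)

⌈_/suc_⌉ : ℕ → ℕ → ℕ
⌈ a /suc b ⌉ = (a + b) / suc b

B₁-corr : ℕ → ℕ → ℕ
B₁-corr r k with r
... | 0 = k + 1
... | 1 = 0
... | _ = k

B₁ : ℕ → ℕ → ℕ
B₁ n k = ⌈ 4 * n /suc 2 ⌉ * (k + 1) + B₁-corr (n % 3) k

B₂ : ℕ → ℕ → ℕ
B₂ n k = 6 * (n ∸ 2) * ⌈ k + 4 /suc 4 ⌉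
       + 12 * ⌈ k + 3 ∸ ⌈ k + 4 /suc 4 ⌉ /suc 2 ⌉

B₃ : ℕ → ℕ → ℕ
B₃ n k = 6 * (n ∸ 2) * ⌈ k + 5 /suc 4 ⌉
       + 12 * ⌈ k + 3 ∸ ⌈ k + 5 /suc 4 ⌉ /suc 2 ⌉
       ∸ 2 * ⌈ n /suc 1 ⌉

{-# OPTIONS --safe #-}
-- With a = ⌈(k+4)/5⌉ and b = ⌈(k+5)/5⌉, up to intercepts of size O(k) the bounds are lines in n:
-- 3B₁ ≥ 4(k+1)n, B₂ = 6an and B₃ = (6b − 1)n.
-- If k ≡ 1 (mod 5) then b = a + 1, so B₃ is steeper than B₂, and 18a < 4(k+1) once k ≥ 31.
-- Otherwise a = b, so B₃ ≤ B₂ outright, and 3(6b − 1) < 4(k+1) once k ≥ 53.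
-- A line of smaller slope lies below one of larger slope once n exceeds the intercept.
module Submission where

open import Defs
open import Algebra.Properties.CommutativeSemigroup as CommutativeSemigroupProperties using ()
open import Data.Empty using (⊥-elim)
open import Data.Nat using (ℕ; suc; _+_; _*_; _∸_; _/_; _%_; _≤_; _<_; s≤s; _≤?_)
open import Data.Nat.DivMod using (m≡m%n+[m/n]*n; m%n<n; m/n*n≤m; m*n/n≡m; +-distrib-/-∣ʳ)
open import Data.Nat.Divisibility using (n∣m*n)
open import Data.Nat.Properties
open import Data.Nat.Tactic.RingSolver using (solve-∀)
open import Data.Product using (_×_; _,_; ∃-syntax)
open import Relation.Binary.PropositionalEquality
  using (_≡_; _≢_; refl; sym; trans; cong; subst; module ≡-Reasoning)
open import Relation.Nullary using (yes; no)

open CommutativeSemigroupProperties +-commutativeSemigroup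
  using () renaming (xy∙z≈xz∙y to +-rightComm)
open CommutativeSemigroupProperties *-commutativeSemigroup
  using () renaming (xy∙z≈xz∙y to *-rightComm)

≤-elim : ∀ (P : ℕ → Set) {m n} → (∀ t → P (m + t)) → m ≤ n → P n
≤-elim P p m≤n with t , m+t≡n ← m≤n⇒∃[o]m+o≡n m≤n = subst P m+t≡n (p t)

≤-by-slack : ∀ {m n} o → m + o ≡ n → m ≤ n
≤-by-slack {m} o m+o≡n = m+n≤o⇒m≤o m (≤-reflexive m+o≡n)

below-steeper-line : ∀ {u v} p q c n → p < q → c ≤ n → u ≤ p * n + c → q * n ≤ v → u ≤ v
below-steeper-line {u} {v} p q c n p<q c≤n u≤pn+c qn≤v = begin
  u          ≤⟨ u≤pn+c ⟩
  p * n + c  ≤⟨ +-monoʳ-≤ (p * n) c≤n ⟩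
  p * n + n  ≡⟨ +-comm (p * n) n ⟩
  suc p * n  ≤⟨ *-monoˡ-≤ n p<q ⟩
  q * n      ≤⟨ qn≤v ⟩
  v          ∎
  where open ≤-Reasoning

m≤⌈m/n⌉*n : ∀ m d → m ≤ ⌈ m /suc d ⌉ * suc d
m≤⌈m/n⌉*n m d = +-cancelˡ-≤ d m (⌈ m /suc d ⌉ * suc d) (begin
  d + m                                     ≡⟨ +-comm d m ⟩
  m + d                                     ≡⟨ m≡m%n+[m/n]*n (m + d) (suc d) ⟩
  (m + d) % suc d + ⌈ m /suc d ⌉ * suc d   ≤⟨ +-monoˡ-≤ _ (≤-pred (m%n<n (m + d) (suc d))) ⟩
  d + ⌈ m /suc d ⌉ * suc d                  ∎)
  where open ≤-Reasoning

⌈m/n⌉*n≤m+d : ∀ m d → ⌈ m /suc d ⌉ * suc d ≤ m + d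
⌈m/n⌉*n≤m+d m d = m/n*n≤m (m + d) (suc d)

⌈[m+kn]/n⌉≡⌈m/n⌉+k : ∀ m k d → ⌈ m + k * suc d /suc d ⌉ ≡ ⌈ m /suc d ⌉ + k
⌈[m+kn]/n⌉≡⌈m/n⌉+k m k d = begin
  (m + k * suc d + d) / suc d          ≡⟨ cong (_/ suc d) (+-rightComm m (k * suc d) d) ⟩
  (m + d + k * suc d) / suc d          ≡⟨ +-distrib-/-∣ʳ (m + d) (n∣m*n k) ⟩
  (m + d) / suc d + k * suc d / suc d  ≡⟨ cong ((m + d) / suc d +_) (m*n/n≡m k (suc d)) ⟩
  (m + d) / suc d + k                  ∎
  where open ≡-Reasoning

⌈[m+j]/n⌉≡⌈[m%n+j]/n⌉+m/n : ∀ m j d → ⌈ m + j /suc d ⌉ ≡ ⌈ m % suc d + j /suc d ⌉ + m / suc d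
⌈[m+j]/n⌉≡⌈[m%n+j]/n⌉+m/n m j d = begin
  ⌈ m + j /suc d ⌉                            ≡⟨ cong ⌈_/suc d ⌉ m+j≡[m%n+j]+[m/n]*n ⟩
  ⌈ m % suc d + j + m / suc d * suc d /suc d ⌉ ≡⟨ ⌈[m+kn]/n⌉≡⌈m/n⌉+k (m % suc d + j) (m / suc d) d ⟩
  ⌈ m % suc d + j /suc d ⌉ + m / suc d          ∎
  where
  open ≡-Reasoning
  m+j≡[m%n+j]+[m/n]*n : m + j ≡ m % suc d + j + m / suc d * suc d
  m+j≡[m%n+j]+[m/n]*n = trans (cong (_+ j) (m≡m%n+[m/n]*n m (suc d)))
                              (+-rightComm (m % suc d) (m / suc d * suc d) j)

B₂₃-const : ℕ → ℕ → ℕ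
B₂₃-const x k = ⌈ k + 3 ∸ x /suc 2 ⌉

-- B₂ n k and B₃ n k are definitionally B₂₃ ⌈(k+4)/5⌉ n k and B₂₃ ⌈(k+5)/5⌉ n k ∸ 2⌈n/2⌉.
B₂₃ : ℕ → ℕ → ℕ → ℕ
B₂₃ x n k = 6 * (n ∸ 2) * x + 12 * B₂₃-const x k

k%5≡1⇒⌈[k+4]/5⌉*5≡k+4 : ∀ k → k % 5 ≡ 1 → ⌈ k + 4 /suc 4 ⌉ * 5 ≡ k + 4
k%5≡1⇒⌈[k+4]/5⌉*5≡k+4 k k%5≡1 = begin
  ⌈ k + 4 /suc 4 ⌉ * 5                 ≡⟨ cong (_* 5) (⌈[m+j]/n⌉≡⌈[m%n+j]/n⌉+m/n k 4 4) ⟩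
  (⌈ k % 5 + 4 /suc 4 ⌉ + k / 5) * 5   ≡⟨ cong (λ r → (⌈ r + 4 /suc 4 ⌉ + k / 5) * 5) k%5≡1 ⟩
  5 + k / 5 * 5                        ≡⟨ cong suc (+-comm 4 (k / 5 * 5)) ⟩
  1 + k / 5 * 5 + 4                    ≡⟨ cong (λ r → r + k / 5 * 5 + 4) (sym k%5≡1) ⟩
  k % 5 + k / 5 * 5 + 4                ≡⟨ cong (_+ 4) (sym (m≡m%n+[m/n]*n k 5)) ⟩
  k + 4                                ∎
  where open ≡-Reasoning

k%5≡1⇒⌈[k+5]/5⌉≡1+⌈[k+4]/5⌉ : ∀ k → k % 5 ≡ 1 → ⌈ k + 5 /suc 4 ⌉ ≡ suc ⌈ k + 4 /suc 4 ⌉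
k%5≡1⇒⌈[k+5]/5⌉≡1+⌈[k+4]/5⌉ k k%5≡1 = begin
  ⌈ k + 5 /suc 4 ⌉                     ≡⟨ ⌈[m+j]/n⌉≡⌈[m%n+j]/n⌉+m/n k 5 4 ⟩
  ⌈ k % 5 + 5 /suc 4 ⌉ + k / 5         ≡⟨ cong (λ r → ⌈ r + 5 /suc 4 ⌉ + k / 5) k%5≡1 ⟩
  suc (⌈ 1 + 4 /suc 4 ⌉ + k / 5)       ≡⟨ cong (λ r → suc (⌈ r + 4 /suc 4 ⌉ + k / 5)) (sym k%5≡1) ⟩
  suc (⌈ k % 5 + 4 /suc 4 ⌉ + k / 5)   ≡⟨ cong suc (⌈[m+j]/n⌉≡⌈[m%n+j]/n⌉+m/n k 4 4) ⟨
  suc ⌈ k + 4 /suc 4 ⌉                 ∎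
  where open ≡-Reasoning

k%5≢1⇒⌈[k+5]/5⌉≡⌈[k+4]/5⌉ : ∀ k → k % 5 ≢ 1 → ⌈ k + 5 /suc 4 ⌉ ≡ ⌈ k + 4 /suc 4 ⌉
k%5≢1⇒⌈[k+5]/5⌉≡⌈[k+4]/5⌉ k k%5≢1 = begin
  ⌈ k + 5 /suc 4 ⌉                ≡⟨ ⌈[m+j]/n⌉≡⌈[m%n+j]/n⌉+m/n k 5 4 ⟩
  ⌈ k % 5 + 5 /suc 4 ⌉ + k / 5    ≡⟨ cong (_+ k / 5) (residue (k % 5) (m%n<n k 5) k%5≢1) ⟩
  ⌈ k % 5 + 4 /suc 4 ⌉ + k / 5    ≡⟨ ⌈[m+j]/n⌉≡⌈[m%n+j]/n⌉+m/n k 4 4 ⟨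
  ⌈ k + 4 /suc 4 ⌉                ∎
  where
  open ≡-Reasoning
  residue : ∀ r → r < 5 → r ≢ 1 → ⌈ r + 5 /suc 4 ⌉ ≡ ⌈ r + 4 /suc 4 ⌉
  residue 0 _ _ = refl
  residue 1 _ r≢1 = ⊥-elim (r≢1 refl)
  residue 2 _ _ = refl
  residue 3 _ _ = refl
  residue 4 _ _ = refl
  residue (suc (suc (suc (suc (suc _))))) (s≤s (s≤s (s≤s (s≤s (s≤s ()))))) _

k%5≢1⇒⌈[k+5]/5⌉*5≤k+8 : ∀ k → k % 5 ≢ 1 → ⌈ k + 5 /suc 4 ⌉ * 5 ≤ k + 8
k%5≢1⇒⌈[k+5]/5⌉*5≤k+8 k k%5≢1 = begin
  ⌈ k + 5 /suc 4 ⌉ * 5   ≡⟨ cong (_* 5) (k%5≢1⇒⌈[k+5]/5⌉≡⌈[k+4]/5⌉ k k%5≢1) ⟩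
  ⌈ k + 4 /suc 4 ⌉ * 5   ≤⟨ ⌈m/n⌉*n≤m+d (k + 4) 4 ⟩
  k + 4 + 4              ≡⟨ +-assoc k 4 4 ⟩
  k + 8                  ∎
  where open ≤-Reasoning

5[1+18x]≡18[x*5]+5 : ∀ x → 5 * suc (18 * x) ≡ 18 * (x * 5) + 5
5[1+18x]≡18[x*5]+5 = solve-∀

a*5≤k+4⇒18a<4[k+1] : ∀ {a k} → a * 5 ≤ k + 4 → 31 ≤ k → 18 * a < 4 * (k + 1)
a*5≤k+4⇒18a<4[k+1] {a} {k} a*5≤k+4 31≤k = *-cancelˡ-≤ 5 (begin
  5 * suc (18 * a)    ≡⟨ 5[1+18x]≡18[x*5]+5 a ⟩
  18 * (a * 5) + 5    ≤⟨ +-monoˡ-≤ 5 (*-monoʳ-≤ 18 a*5≤k+4) ⟩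
  18 * (k + 4) + 5    ≤⟨ ≤-elim (λ k → 18 * (k + 4) + 5 ≤ 5 * (4 * (k + 1)))
                                (λ t → ≤-by-slack (5 + 2 * t) (slack t)) 31≤k ⟩
  5 * (4 * (k + 1))   ∎)
  where
  open ≤-Reasoning
  slack : ∀ t → 18 * (31 + t + 4) + 5 + (5 + 2 * t) ≡ 5 * (4 * (31 + t + 1))
  slack = solve-∀

-- The bound b * 5 ≤ k + 8 alone is too weak below k = 57; there b ≤ 12 is used instead.
b*5≤k+8⇒18b<4[k+1]+3 : ∀ {b k} → b * 5 ≤ k + 8 → 53 ≤ k → 18 * b < 4 * (k + 1) + 3
b*5≤k+8⇒18b<4[k+1]+3 {b} {k} b*5≤k+8 53≤k with b ≤? 12
... | yes b≤12 = begin-strict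
  18 * b            ≤⟨ *-monoʳ-≤ 18 b≤12 ⟩
  216               <⟨ m≤m+n 217 2 ⟩
  4 * (53 + 1) + 3  ≤⟨ +-monoˡ-≤ 3 (*-monoʳ-≤ 4 (+-monoˡ-≤ 1 53≤k)) ⟩
  4 * (k + 1) + 3   ∎
  where open ≤-Reasoning
... | no b≰12 = *-cancelˡ-≤ 5 (begin
  5 * suc (18 * b)        ≡⟨ 5[1+18x]≡18[x*5]+5 b ⟩
  18 * (b * 5) + 5        ≤⟨ +-monoˡ-≤ 5 (*-monoʳ-≤ 18 b*5≤k+8) ⟩
  18 * (k + 8) + 5        ≤⟨ ≤-elim (λ k → 18 * (k + 8) + 5 ≤ 5 * (4 * (k + 1) + 3))
                                    (λ t → ≤-by-slack (2 * t) (slack t)) 57≤k ⟩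
  5 * (4 * (k + 1) + 3)   ∎)
  where
  open ≤-Reasoning
  57≤k : 57 ≤ k
  57≤k = +-cancelʳ-≤ 8 57 k (≤-trans (*-monoˡ-≤ 5 (≰⇒> b≰12)) b*5≤k+8)
  slack : ∀ t → 18 * (57 + t + 8) + 5 + 2 * t ≡ 5 * (4 * (57 + t + 1) + 3)
  slack = solve-∀

4[k+1]n≤3B₁ : ∀ n k → 4 * (k + 1) * n ≤ 3 * B₁ n k
4[k+1]n≤3B₁ n k = begin
  4 * (k + 1) * n         ≡⟨ *-rightComm 4 (k + 1) n ⟩
  4 * n * (k + 1)         ≤⟨ *-monoˡ-≤ (k + 1) (m≤⌈m/n⌉*n (4 * n) 2) ⟩
  c * 3 * (k + 1)         ≡⟨ regroup c k ⟩
  3 * (c * (k + 1))       ≤⟨ *-monoʳ-≤ 3 (m≤m+n (c * (k + 1)) (B₁-corr (n % 3) k)) ⟩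
  3 * B₁ n k              ∎
  where
  open ≤-Reasoning
  c = ⌈ 4 * n /suc 2 ⌉
  regroup : ∀ c k → c * 3 * (k + 1) ≡ 3 * (c * (k + 1))
  regroup = solve-∀

3B₂₃≤18xn+36c : ∀ x n k → 3 * B₂₃ x n k ≤ 18 * x * n + 36 * B₂₃-const x k
3B₂₃≤18xn+36c x n k = begin
  3 * (6 * (n ∸ 2) * x + 12 * c)  ≤⟨ *-monoʳ-≤ 3 (+-monoˡ-≤ (12 * c) (*-monoˡ-≤ x 6[n∸2]≤6n)) ⟩
  3 * (6 * n * x + 12 * c)        ≡⟨ regroup x n c ⟩
  18 * x * n + 36 * c             ∎
  where
  open ≤-Reasoning
  c = B₂₃-const x k
  6[n∸2]≤6n : 6 * (n ∸ 2) ≤ 6 * n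
  6[n∸2]≤6n = *-monoʳ-≤ 6 (m∸n≤m n 2)
  regroup : ∀ x n c → 3 * (6 * n * x + 12 * c) ≡ 18 * x * n + 36 * c
  regroup = solve-∀

B₂₃≤B₁ : ∀ x n k → 18 * x < 4 * (k + 1) → 36 * B₂₃-const x k ≤ n → B₂₃ x n k ≤ B₁ n k
B₂₃≤B₁ x n k slope 36c≤n = *-cancelˡ-≤ 3 (below-steeper-line (18 * x) (4 * (k + 1)) _ n slope 36c≤n
  (3B₂₃≤18xn+36c x n k) (4[k+1]n≤3B₁ n k))

B₂₃∸2⌈n/2⌉≤B₁ : ∀ x n k → 18 * x < 4 * (k + 1) + 3 → 36 * B₂₃-const x k ≤ n →
                B₂₃ x n k ∸ 2 * ⌈ n /suc 1 ⌉ ≤ B₁ n k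
B₂₃∸2⌈n/2⌉≤B₁ x n k slope 36c≤n = ≤-trans (∸-monoʳ-≤ (B₂₃ x n k) n≤2⌈n/2⌉)
  (m≤n+o⇒m∸n≤o (B₂₃ x n k) n (*-cancelˡ-≤ 3
    (below-steeper-line (18 * x) (4 * (k + 1) + 3) _ n slope 36c≤n (3B₂₃≤18xn+36c x n k) qn≤3[n+B₁])))
  where
  open ≤-Reasoning
  n≤2⌈n/2⌉ : n ≤ 2 * ⌈ n /suc 1 ⌉
  n≤2⌈n/2⌉ = ≤-trans (m≤⌈m/n⌉*n n 1) (≤-reflexive (*-comm ⌈ n /suc 1 ⌉ 2))
  qn≤3[n+B₁] : (4 * (k + 1) + 3) * n ≤ 3 * (n + B₁ n k)
  qn≤3[n+B₁] = begin
    (4 * (k + 1) + 3) * n        ≡⟨ *-distribʳ-+ n (4 * (k + 1)) 3 ⟩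
    4 * (k + 1) * n + 3 * n      ≤⟨ +-monoˡ-≤ (3 * n) (4[k+1]n≤3B₁ n k) ⟩
    3 * B₁ n k + 3 * n           ≡⟨ +-comm (3 * B₁ n k) (3 * n) ⟩
    3 * n + 3 * B₁ n k           ≡⟨ *-distribˡ-+ 3 n (B₁ n k) ⟨
    3 * (n + B₁ n k)             ∎

B₂₃≤B₂₃[1+x]∸2⌈n/2⌉ : ∀ x n k → 5 + 12 * B₂₃-const x k ≤ n →
                      B₂₃ x n k ≤ B₂₃ (suc x) n k ∸ 2 * ⌈ n /suc 1 ⌉
B₂₃≤B₂₃[1+x]∸2⌈n/2⌉ x (suc (suc p)) k (s≤s (s≤s 3+12c≤p)) = m+n≤o⇒m≤o∸n (B₂₃ x n k) (begin
  6 * p * x + 12 * c + 2 * ⌈ n /suc 1 ⌉  ≤⟨ +-monoʳ-≤ (6 * p * x + 12 * c) 2⌈n/2⌉≤n+1 ⟩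
  6 * p * x + 12 * c + (n + 1)          ≡⟨ regroup p x c ⟩
  6 * p * x + (3 + 12 * c) + p          ≤⟨ +-monoˡ-≤ p (+-monoʳ-≤ (6 * p * x) 3+12c≤p) ⟩
  6 * p * x + p + p                     ≤⟨ m≤m+n (6 * p * x + p + p) (4 * p) ⟩
  6 * p * x + p + p + 4 * p             ≡⟨ expand p x ⟨
  6 * p * suc x                         ≤⟨ m≤m+n (6 * p * suc x) (12 * B₂₃-const (suc x) k) ⟩
  B₂₃ (suc x) n k                       ∎)
  where
  open ≤-Reasoning
  n = suc (suc p)
  c = B₂₃-const x k
  2⌈n/2⌉≤n+1 : 2 * ⌈ n /suc 1 ⌉ ≤ n + 1
  2⌈n/2⌉≤n+1 = ≤-trans (≤-reflexive (*-comm 2 ⌈ n /suc 1 ⌉)) (⌈m/n⌉*n≤m+d n 1)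
  regroup : ∀ p x c → 6 * p * x + 12 * c + (suc (suc p) + 1) ≡ 6 * p * x + (3 + 12 * c) + p
  regroup = solve-∀
  expand : ∀ p x → 6 * p * suc x ≡ 6 * p * x + p + p + 4 * p
  expand = solve-∀

B₂-eventually-least : ∀ k → k % 5 ≡ 1 → 31 ≤ k →
                      ∃[ N ] ∀ n → 4 ≤ n → N ≤ n → (B₂ n k ≤ B₁ n k × B₂ n k ≤ B₃ n k)
B₂-eventually-least k k%5≡1 31≤k = 5 + 36 * c , λ n _ N≤n →
    B₂₃≤B₁ a n k slope (m+n≤o⇒n≤o 5 N≤n)
  , subst (λ b → B₂ n k ≤ B₂₃ b n k ∸ 2 * ⌈ n /suc 1 ⌉)
          (sym (k%5≡1⇒⌈[k+5]/5⌉≡1+⌈[k+4]/5⌉ k k%5≡1))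
          (B₂₃≤B₂₃[1+x]∸2⌈n/2⌉ a n k (≤-trans 5+12c≤5+36c N≤n))
  where
  a = ⌈ k + 4 /suc 4 ⌉
  c = B₂₃-const a k
  5+12c≤5+36c : 5 + 12 * c ≤ 5 + 36 * c
  5+12c≤5+36c = +-monoʳ-≤ 5 (*-monoˡ-≤ c (m≤m+n 12 24))
  slope : 18 * a < 4 * (k + 1)
  slope = a*5≤k+4⇒18a<4[k+1] {a} (≤-reflexive (k%5≡1⇒⌈[k+4]/5⌉*5≡k+4 k k%5≡1)) 31≤k

B₃-eventually-least : ∀ k → k % 5 ≢ 1 → 53 ≤ k →
                      ∃[ N ] ∀ n → 4 ≤ n → N ≤ n → (B₃ n k ≤ B₁ n k × B₃ n k ≤ B₂ n k)
B₃-eventually-least k k%5≢1 53≤k = 36 * B₂₃-const b k , λ n _ N≤n →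
    B₂₃∸2⌈n/2⌉≤B₁ b n k slope N≤n
  , ≤-trans (m∸n≤m (B₂₃ b n k) (2 * ⌈ n /suc 1 ⌉))
            (≤-reflexive (cong (λ x → B₂₃ x n k) (k%5≢1⇒⌈[k+5]/5⌉≡⌈[k+4]/5⌉ k k%5≢1)))
  where
  b = ⌈ k + 5 /suc 4 ⌉
  slope : 18 * b < 4 * (k + 1) + 3
  slope = b*5≤k+8⇒18b<4[k+1]+3 {b} (k%5≢1⇒⌈[k+5]/5⌉*5≤k+8 k k%5≢1) 53≤k

theorem13 : (∀ k → k % 5 ≡ 1 → 31 ≤ k →
                 ∃[ N ] ∀ n → 4 ≤ n → N ≤ n →
                   (B₂ n k ≤ B₁ n k × B₂ n k ≤ B₃ n k))
              × (∀ k → k % 5 ≢ 1 → 53 ≤ k →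
                 ∃[ N ] ∀ n → 4 ≤ n → N ≤ n →
                   (B₃ n k ≤ B₁ n k × B₃ n k ≤ B₂ n k))
theorem13 = B₂-eventually-least , B₃-eventually-least
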